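{- Let $\mathcal{G}$ be a finite simple undirected graph and let $H_1$, $H_2$ be F-twin induced subgraphs of $\mathcal{G}$ with disjoint vertex sets $V(H_1)$, $V(H_2)$, and let $\varphi:V(H_1)\to V(H_2)$ be an isomorphism witnessing the F-twin relation. Let $(u_0,\ldots,u_k)$ be a vertex sequence defining a path of length $k$ in $\mathcal{G}$. Define $$v_i=\begin{cases}\varphi(u_i) & \text{if } u_i\in V(H_1),\\ \varphi^{ -1}(u_i) & \text{if } u_i\in V(H_2),\\ u_i & \text{if } u_i\notin V(H_1)\cup V(H_2).\end{cases}$$ Then $(v_0,\ldots,v_k)$ also defines a path of length $k$ in $\mathcal{G}$.
   Context: All graphs are finite, undirected, without loops or parallel edges. For a vertex $u$, $\mathcal{N}(u)$ denotes the set of vertices adjacent to $u$. Two induced subgraphs $H_1,H_2$ of $\mathcal{G}$ with vertex sets $V_1,V_2$ are called F-twins if there is a graph isomorphism $\varphi:V_1\to V_2$ between $H_1$ and $H_2$ such that $\mathcal{N}(u)-V_1=\mathcal{N}(\varphi(u))-V_2$ for all $u\in V_1$ (such $\varphi$ is said to witness the F-twin relation). A path of length $k$ is given by $k+1$ distinct vertices $v_0,\dots,v_k$ with $v_{i-1}$ adjacent to $v_i$ for each $i$. -}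

module Defs where

open import Data.Nat using (ℕ; suc)
open import Data.Fin using (Fin; suc; inject₁)
open import Data.Fin.Subset using (Subset; _∈_; _∉_; Empty; _∩_)
open import Data.Fin.Subset.Properties using (_∈?_)
open import Data.Product using (_×_; Σ)
open import Relation.Binary.PropositionalEquality using (_≡_)
open import Relation.Nullary using (¬_; yes; no)
open import Function.Bundles using (_⇔_)
open import Function.Definitions using (Injective)
open import Level using (0ℓ)

record Graph (n : ℕ) : Set₁ where
  field
    Adj     : Fin n → Fin n → Set
    symmetric   : ∀ {x y} → Adj x y → Adj y x
    irreflexive : ∀ {x} → ¬ Adj x x
open Graph public

-- φ : V₁ → V₂ is a bijection (given as a function on Fin n together with
-- its inverse ψ, both meaningful only on V₁ resp. V₂).
record Bij {n : ℕ} (V₁ V₂ : Subset n) (φ ψ : Fin n → Fin n) : Set where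
  field
    φ-into : ∀ {u} → u ∈ V₁ → φ u ∈ V₂
    ψ-into : ∀ {w} → w ∈ V₂ → ψ w ∈ V₁
    ψφ     : ∀ {u} → u ∈ V₁ → ψ (φ u) ≡ u
    φψ     : ∀ {w} → w ∈ V₂ → φ (ψ w) ≡ w

-- φ (with inverse ψ) witnesses that the induced subgraphs G[V₁], G[V₂]
-- are F-twins: φ is a graph isomorphism G[V₁] ≅ G[V₂] and
-- N(u) - V₁ = N(φ u) - V₂ for all u ∈ V₁.
record FTwinWitness {n : ℕ} (G : Graph n) (V₁ V₂ : Subset n)
                    (φ ψ : Fin n → Fin n) : Set where
  field
    bij  : Bij V₁ V₂ φ ψ
    iso  : ∀ {u w} → u ∈ V₁ → w ∈ V₁ → Adj G u w ⇔ Adj G (φ u) (φ w)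
    twin : ∀ {u} → u ∈ V₁ → ∀ x →
           (Adj G u x × x ∉ V₁) ⇔ (Adj G (φ u) x × x ∉ V₂)

IsPath : {n : ℕ} → Graph n → (k : ℕ) → (Fin (suc k) → Fin n) → Set
IsPath G k v = Injective _≡_ _≡_ v
             × (∀ (i : Fin k) → Adj G (v (inject₁ i)) (v (suc i)))

swap : {n : ℕ} (V₁ V₂ : Subset n) (φ ψ : Fin n → Fin n) → Fin n → Fin n
swap V₁ V₂ φ ψ u with u ∈? V₁
... | yes _ = φ u
... | no _ with u ∈? V₂
...   | yes _ = ψ u
...   | no _  = u

-- The map swapping V₁ and V₂ along φ is an involution, hence injective.  It
-- preserves adjacency: inside V₁ or inside V₂ by the isomorphism, between
-- V₁ ∪ V₂ and the rest by the twin condition; and no edge joins V₁ to V₂,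
-- since by the twin condition the neighbours of x ∈ V₁ outside V₁ lie outside V₂.
module Submission where

open import Defs
open import Data.Nat using (ℕ; suc)
open import Data.Fin using (Fin)
open import Data.Fin.Subset using (Subset; _∩_; Empty; _∈_; _∉_)
open import Data.Fin.Subset.Properties using (_∈?_; x∈p∩q⁺)
open import Data.Product using (_,_; proj₁; proj₂)
open import Data.Empty using (⊥-elim)
open import Function.Base using (_∘_)
open import Function.Bundles using (Equivalence)
open import Function.Definitions using (Injective)
open import Relation.Nullary using (¬_; yes; no; contradiction)
open import Relation.Binary.PropositionalEquality
  using (_≡_; refl; sym; cong; subst; subst₂; module ≡-Reasoning)

private
  variable
    n : ℕ
    G : Graph n
    V₁ V₂ : Subset n
    φ ψ : Fin n → Fin n
    x y : Fin n

data Region (V₁ V₂ : Subset n) (x : Fin n) : Set where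
  inV₁    : x ∈ V₁ → Region V₁ V₂ x
  inV₂    : x ∈ V₂ → Region V₁ V₂ x
  outside : x ∉ V₁ → x ∉ V₂ → Region V₁ V₂ x

region : (V₁ V₂ : Subset n) (x : Fin n) → Region V₁ V₂ x
region V₁ V₂ x with x ∈? V₁ | x ∈? V₂
... | yes x∈V₁ | _        = inV₁ x∈V₁
... | no _     | yes x∈V₂ = inV₂ x∈V₂
... | no x∉V₁  | no x∉V₂  = outside x∉V₁ x∉V₂

∈₁⇒∉₂ : Empty (V₁ ∩ V₂) → x ∈ V₁ → x ∉ V₂
∈₁⇒∉₂ disjoint x∈V₁ x∈V₂ = disjoint (_ , x∈p∩q⁺ (x∈V₁ , x∈V₂))

∈₂⇒∉₁ : Empty (V₁ ∩ V₂) → x ∈ V₂ → x ∉ V₁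
∈₂⇒∉₁ disjoint x∈V₂ x∈V₁ = ∈₁⇒∉₂ disjoint x∈V₁ x∈V₂

swap-∈₁ : x ∈ V₁ → swap V₁ V₂ φ ψ x ≡ φ x
swap-∈₁ {x = x} {V₁ = V₁} x∈V₁ with x ∈? V₁
... | yes _    = refl
... | no x∉V₁  = contradiction x∈V₁ x∉V₁

swap-∈₂ : Empty (V₁ ∩ V₂) → x ∈ V₂ → swap V₁ V₂ φ ψ x ≡ ψ x
swap-∈₂ {V₁ = V₁} {V₂ = V₂} {x = x} disjoint x∈V₂ with x ∈? V₁
... | yes x∈V₁ = contradiction x∈V₁ (∈₂⇒∉₁ disjoint x∈V₂)
... | no _ with x ∈? V₂
...   | yes _   = refl
...   | no x∉V₂ = contradiction x∈V₂ x∉V₂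

swap-∉ : x ∉ V₁ → x ∉ V₂ → swap V₁ V₂ φ ψ x ≡ x
swap-∉ {x = x} {V₁ = V₁} {V₂ = V₂} x∉V₁ x∉V₂ with x ∈? V₁
... | yes x∈V₁ = contradiction x∈V₁ x∉V₁
... | no _ with x ∈? V₂
...   | yes x∈V₂ = contradiction x∈V₂ x∉V₂
...   | no _     = refl

swap-involutive : Empty (V₁ ∩ V₂) → Bij V₁ V₂ φ ψ →
                  ∀ x → swap V₁ V₂ φ ψ (swap V₁ V₂ φ ψ x) ≡ x
swap-involutive {V₁ = V₁} {V₂ = V₂} {φ = φ} {ψ = ψ} disjoint bij x
  with region V₁ V₂ x
... | inV₁ x∈V₁ = begin
  s (s x)   ≡⟨ cong s (swap-∈₁ x∈V₁) ⟩
  s (φ x)   ≡⟨ swap-∈₂ disjoint (φ-into x∈V₁) ⟩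
  ψ (φ x)   ≡⟨ ψφ x∈V₁ ⟩
  x         ∎
  where open Bij bij; open ≡-Reasoning; s = swap V₁ V₂ φ ψ
... | inV₂ x∈V₂ = begin
  s (s x)   ≡⟨ cong s (swap-∈₂ disjoint x∈V₂) ⟩
  s (ψ x)   ≡⟨ swap-∈₁ (ψ-into x∈V₂) ⟩
  φ (ψ x)   ≡⟨ φψ x∈V₂ ⟩
  x         ∎
  where open Bij bij; open ≡-Reasoning; s = swap V₁ V₂ φ ψ
... | outside x∉V₁ x∉V₂ = begin
  s (s x)   ≡⟨ cong s (swap-∉ x∉V₁ x∉V₂) ⟩
  s x       ≡⟨ swap-∉ x∉V₁ x∉V₂ ⟩
  x         ∎
  where open ≡-Reasoning; s = swap V₁ V₂ φ ψ

swap-injective : Empty (V₁ ∩ V₂) → Bij V₁ V₂ φ ψ →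
                 Injective _≡_ _≡_ (swap V₁ V₂ φ ψ)
swap-injective {V₁ = V₁} {V₂ = V₂} {φ = φ} {ψ = ψ} disjoint bij {x} {y} sx≡sy = begin
  x         ≡⟨ sym (swap-involutive disjoint bij x) ⟩
  s (s x)   ≡⟨ cong s sx≡sy ⟩
  s (s y)   ≡⟨ swap-involutive disjoint bij y ⟩
  y         ∎
  where open ≡-Reasoning; s = swap V₁ V₂ φ ψ

module _ (disjoint : Empty (V₁ ∩ V₂)) (W : FTwinWitness G V₁ V₂ φ ψ) where
  open FTwinWitness W
  open Bij bij
  open Equivalence

  private
    s : Fin _ → Fin _
    s = swap V₁ V₂ φ ψ

  no-edge-between : x ∈ V₁ → y ∈ V₂ → ¬ Adj G x y
  no-edge-between {y = y} x∈V₁ y∈V₂ x~y =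
    proj₂ (to (twin x∈V₁ y) (x~y , ∈₂⇒∉₁ disjoint y∈V₂)) y∈V₂

  φ-adj-outside : x ∈ V₁ → y ∉ V₁ → Adj G x y → Adj G (φ x) y
  φ-adj-outside {y = y} x∈V₁ y∉V₁ x~y = proj₁ (to (twin x∈V₁ y) (x~y , y∉V₁))

  ψ-adj-outside : x ∈ V₂ → y ∉ V₂ → Adj G x y → Adj G (ψ x) y
  ψ-adj-outside {y = y} x∈V₂ y∉V₂ x~y =
    proj₁ (from (twin (ψ-into x∈V₂) y) (subst (λ z → Adj G z y) (sym (φψ x∈V₂)) x~y , y∉V₂))

  ψ-adj-inside : x ∈ V₂ → y ∈ V₂ → Adj G x y → Adj G (ψ x) (ψ y)
  ψ-adj-inside x∈V₂ y∈V₂ x~y =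
    from (iso (ψ-into x∈V₂) (ψ-into y∈V₂)) (subst₂ (Adj G) (sym (φψ x∈V₂)) (sym (φψ y∈V₂)) x~y)

  swap-adj-∈₁ : x ∈ V₁ → Adj G x y → Adj G (s x) (s y)
  swap-adj-∈₁ {y = y} x∈V₁ x~y with region V₁ V₂ y
  ... | inV₁ y∈V₁ =
    subst₂ (Adj G) (sym (swap-∈₁ x∈V₁)) (sym (swap-∈₁ y∈V₁)) (to (iso x∈V₁ y∈V₁) x~y)
  ... | inV₂ y∈V₂ = ⊥-elim (no-edge-between x∈V₁ y∈V₂ x~y)
  ... | outside y∉V₁ y∉V₂ =
    subst₂ (Adj G) (sym (swap-∈₁ x∈V₁)) (sym (swap-∉ y∉V₁ y∉V₂)) (φ-adj-outside x∈V₁ y∉V₁ x~y)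

  swap-adj-∈₂ : x ∈ V₂ → Adj G x y → Adj G (s x) (s y)
  swap-adj-∈₂ {y = y} x∈V₂ x~y with region V₁ V₂ y
  ... | inV₁ y∈V₁ = ⊥-elim (no-edge-between y∈V₁ x∈V₂ (symmetric G x~y))
  ... | inV₂ y∈V₂ =
    subst₂ (Adj G) (sym (swap-∈₂ disjoint x∈V₂)) (sym (swap-∈₂ disjoint y∈V₂))
      (ψ-adj-inside x∈V₂ y∈V₂ x~y)
  ... | outside y∉V₁ y∉V₂ =
    subst₂ (Adj G) (sym (swap-∈₂ disjoint x∈V₂)) (sym (swap-∉ y∉V₁ y∉V₂))
      (ψ-adj-outside x∈V₂ y∉V₂ x~y)

  swap-adj : Adj G x y → Adj G (s x) (s y)
  swap-adj {x = x} {y = y} x~y with region V₁ V₂ x | region V₁ V₂ y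
  ... | inV₁ x∈V₁ | _         = swap-adj-∈₁ x∈V₁ x~y
  ... | inV₂ x∈V₂ | _         = swap-adj-∈₂ x∈V₂ x~y
  ... | outside _ _ | inV₁ y∈V₁ = symmetric G (swap-adj-∈₁ y∈V₁ (symmetric G x~y))
  ... | outside _ _ | inV₂ y∈V₂ = symmetric G (swap-adj-∈₂ y∈V₂ (symmetric G x~y))
  ... | outside x∉V₁ x∉V₂ | outside y∉V₁ y∉V₂ =
    subst₂ (Adj G) (sym (swap-∉ x∉V₁ x∉V₂)) (sym (swap-∉ y∉V₁ y∉V₂)) x~y

lemma1 : ∀ {n : ℕ} (G : Graph n) (V₁ V₂ : Subset n) (φ ψ : Fin n → Fin n) →
         Empty (V₁ ∩ V₂) →
         FTwinWitness G V₁ V₂ φ ψ →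
         (k : ℕ) (u : Fin (suc k) → Fin n) →
         IsPath G k u →
         IsPath G k (swap V₁ V₂ φ ψ ∘ u)
lemma1 G V₁ V₂ φ ψ disjoint W k u (u-injective , u-adjacent) =
    u-injective ∘ swap-injective disjoint (FTwinWitness.bij W)
  , λ i → swap-adj disjoint W (u-adjacent i)
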